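{- Let $G$ be an induced-subgraph-minimal non-sesquicograph that is not isomorphic to a cycle, and let $wxyz$ be a path in $G$ such that both $x$ and $y$ have degree two in $G$. Then $w$ and $z$ are adjacent in $G$.
   Context: For vertex-disjoint graphs $G$ and $H$: the $0$-sum is their disjoint union; a $1$-sum is obtained from the disjoint union by identifying one vertex of $G$ with one vertex of $H$; the join is obtained from the disjoint union by adding all edges between $V(G)$ and $V(H)$. A sesquicograph is a finite simple graph that can be generated from the one-vertex graph $K_1$ using joins, $0$-sums and $1$-sums. An induced-subgraph-minimal non-sesquicograph is a graph that is not a sesquicograph but every proper induced subgraph of which is a sesquicograph. -}

module Defs where

open import Data.Nat using (ℕ; zero; suc; _+_; _<_; _≤_)
open import Data.Fin using (Fin; zero; suc; toℕ; splitAt; punchIn)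
open import Data.Fin.Properties using (_≟_)
open import Data.Bool using (Bool; true; false; _∧_; _∨_; not; if_then_else_)
open import Data.Bool.Properties using (∨-comm)
open import Data.Maybe using (Maybe; just; nothing)
open import Data.Sum using (_⊎_; inj₁; inj₂)
open import Data.Product using (Σ; _×_; _,_)
open import Data.List using (List; map; allFin)
open import Data.Nat.ListAction using (sum)
open import Data.Empty using (⊥)
open import Function.Bundles using (_↔_; Inverse)
open import Relation.Nullary using (¬_; yes; no)
open import Relation.Nullary.Decidable using (⌊_⌋)
open import Relation.Binary.PropositionalEquality using (_≡_; refl; sym; cong)
open import Data.Nat using () renaming (_≡ᵇ_ to _==ℕ_)

record Graph (n : ℕ) : Set where
  field
    adj    : Fin n → Fin n → Bool
    adj-sym    : ∀ i j → adj i j ≡ adj j i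
    adj-irrefl : ∀ i → adj i i ≡ false
open Graph public

_==_ : ∀ {n} → Fin n → Fin n → Bool
i == j = ⌊ i ≟ j ⌋

==-sym : ∀ {n} (i j : Fin n) → (i == j) ≡ (j == i)
==-sym i j with i ≟ j | j ≟ i
... | yes _ | yes _ = refl
... | no _  | no _  = refl
... | yes p | no q  with q (sym p)
... | ()
==-sym i j | no p | yes q with p (sym q)
... | ()

==-refl : ∀ {n} (i : Fin n) → (i == i) ≡ true
==-refl i with i ≟ i
... | yes _ = refl
... | no p with p refl
... | ()

simple : ∀ {n} → (Fin n → Fin n → Bool) → Graph n
simple {n} r = record { adj = a ; adj-sym = s ; adj-irrefl = ir }
  where
  a : Fin n → Fin n → Bool
  a i j = not (i == j) ∧ (r i j ∨ r j i)
  s : ∀ i j → a i j ≡ a j i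
  s i j rewrite ==-sym i j | ∨-comm (r i j) (r j i) = refl
  ir : ∀ i → a i i ≡ false
  ir i rewrite ==-refl i = refl

pull : ∀ {k p} → (Fin k → Maybe (Fin p)) → (Fin p → Fin p → Bool) → Fin k → Fin k → Bool
pull f r i j with f i | f j
... | just a | just b = r a b
... | _      | _      = false

K₁ : Graph 1
K₁ = simple (λ _ _ → false)

-- Vertices of a sum on Fin (n + m): the first n come from G, the last m from H
leftPart : ∀ n {m} → Fin (n + m) → Maybe (Fin n)
leftPart n i with splitAt n i
... | inj₁ a = just a
... | inj₂ _ = nothing

rightPart : ∀ n {m} → Fin (n + m) → Maybe (Fin m)
rightPart n i with splitAt n i
... | inj₁ _ = nothing
... | inj₂ b = just b

crossing : ∀ n {m} → Fin (n + m) → Fin (n + m) → Bool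
crossing n i j with splitAt n i | splitAt n j
... | inj₁ _ | inj₂ _ = true
... | inj₂ _ | inj₁ _ = true
... | _      | _      = false

_⊕_ : ∀ {n m} → Graph n → Graph m → Graph (n + m)
_⊕_ {n} G H = simple (λ i j → pull (leftPart n) (adj G) i j ∨ pull (rightPart n) (adj H) i j)

_⊗_ : ∀ {n m} → Graph n → Graph m → Graph (n + m)
_⊗_ {n} G H = simple (λ i j → pull (leftPart n) (adj G) i j ∨ pull (rightPart n) (adj H) i j
                               ∨ crossing n i j)

-- 1-sum identifying vertex u of G with vertex v of H.
-- Vertex set Fin (suc n + m): the first suc n vertices are those of G,
-- the remaining m are the vertices of H other than v (via punchIn v).
oneLeft : ∀ n {m} → Fin (suc n + m) → Maybe (Fin (suc n))
oneLeft n = leftPart (suc n)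

oneRight : ∀ n {m} → Fin (suc n) → Fin (suc m) → Fin (suc n + m) → Maybe (Fin (suc m))
oneRight n u v i with splitAt (suc n) i
... | inj₁ a = if a == u then just v else nothing
... | inj₂ b = just (punchIn v b)

oneSum : ∀ {n m} → Graph (suc n) → Graph (suc m) → Fin (suc n) → Fin (suc m) → Graph (suc n + m)
oneSum {n} G H u v = simple (λ i j → pull (oneLeft n) (adj G) i j ∨ pull (oneRight n u v) (adj H) i j)

_≅_ : ∀ {n m} → Graph n → Graph m → Set
_≅_ {n} {m} G H = Σ (Fin n ↔ Fin m) λ f →
  ∀ i j → adj H (Inverse.to f i) (Inverse.to f j) ≡ adj G i j

data Sesqui : ∀ {n} → Graph n → Set where
  k₁    : Sesqui K₁
  iso   : ∀ {n m} {G : Graph n} {H : Graph m} → Sesqui G → G ≅ H → Sesqui H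
  sum₀  : ∀ {n m} {G : Graph n} {H : Graph m} → Sesqui G → Sesqui H → Sesqui (G ⊕ H)
  join  : ∀ {n m} {G : Graph n} {H : Graph m} → Sesqui G → Sesqui H → Sesqui (G ⊗ H)
  sum₁  : ∀ {n m} {G : Graph (suc n)} {H : Graph (suc m)} (u : Fin (suc n)) (v : Fin (suc m)) →
          Sesqui G → Sesqui H → Sesqui (oneSum G H u v)

Injective : ∀ {k n} → (Fin k → Fin n) → Set
Injective f = ∀ i j → f i ≡ f j → i ≡ j

induced : ∀ {k n} → Graph n → (Fin k → Fin n) → Graph k
induced G f = record
  { adj = λ i j → adj G (f i) (f j)
  ; adj-sym = λ i j → adj-sym G (f i) (f j)
  ; adj-irrefl = λ i → adj-irrefl G (f i) }

MinimalNonSesqui : ∀ {n} → Graph n → Set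
MinimalNonSesqui {n} G =
  ¬ Sesqui G ×
  (∀ {k} → 0 < k → k < n → (f : Fin k → Fin n) → Injective f → Sesqui (induced G f))

-- The cycle C_k on Fin k (used for k ≥ 3): i ~ j iff j = i + 1, or i = k - 1 and j = 0
-- (i.e. j ≡ i + 1 mod k), or vice versa
Cycle : (k : ℕ) → Graph k
Cycle k = simple (λ i j → (suc (toℕ i) ==ℕ toℕ j) ∨ ((suc (toℕ i) ==ℕ k) ∧ (toℕ j ==ℕ 0)))

Adj : ∀ {n} → Graph n → Fin n → Fin n → Set
Adj G i j = adj G i j ≡ true

degree : ∀ {n} → Graph n → Fin n → ℕ
degree {n} G x = sum (map (λ j → if adj G x j then 1 else 0) (allFin n))

-- Suppose w ≁ z and let B be the set of vertices reachable from w in G − {x, y}.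
-- If z ∉ B then, as the only neighbours of y are x and z, no edge joins B to the vertices
-- outside B ∪ {x}.  So x is a cut vertex and G is the 1-sum at x of two proper induced
-- subgraphs, which are sesquicographs by minimality.
-- If z ∈ B, a shortest w–z path in G − {x, y} has length at least 2 (as w ≁ z) and closes up
-- through y and x, both of degree 2, to an induced cycle of length at least 5.  As G is not a
-- cycle, this is a proper induced subgraph and so a sesquicograph.  But such a cycle is
-- connected, has connected complement and has no cut vertex, whereas K₁ has a single vertex,
-- a 0-sum is disconnected, a join has disconnected complement and a 1-sum has a cut vertex.

module Submission where

open import Defs
open import Data.Nat as ℕ using (ℕ; zero; suc; _+_; _∸_; _≤_; _<_; z≤n; s≤s)
open import Data.Nat.Properties
  using ( ≤-refl; ≤-trans; ≤-antisym; ≤-total; ≤-pred; <-trans; ≤-<-trans; <-≤-trans; <-cmp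
        ; ≰⇒>; <⇒≱; ≮⇒≥; ≤∧≢⇒<; ≤⇒≤′; n≤1+n; n<1+n; m≤m+n; 1+n≰n; 1+n≢n; m≢1+n+m
        ; +-suc; +-identityʳ; m+[n∸m]≡n; suc-injective; module ≤-Reasoning )
open import Data.Nat.ListAction using (sum)
open import Data.Fin using (Fin; zero; suc; toℕ; fromℕ; fromℕ<; splitAt; punchIn; punchOut; _↑ˡ_; _↑ʳ_)
import Data.Fin.Properties as Finₚ
open import Data.Bool using (Bool; true; false; _∧_; _∨_; not; if_then_else_)
import Data.Bool.Properties as Boolₚ
open import Data.List using (map; tabulate)
open import Data.Maybe using (Maybe; just; nothing; is-just)
open import Data.Sum using (_⊎_; inj₁; inj₂; [_,_]′; swap)
open import Data.Product using (Σ; ∃; _×_; _,_; proj₁; proj₂)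
open import Data.Unit using (⊤; tt)
open import Data.Empty using (⊥; ⊥-elim)
open import Data.Vec.Functional using (_∷_; _++_)
import Data.Vec.Functional.Properties as Vectorₚ
open import Function using (_∘_; id)
open import Function.Bundles using (Inverse; mk↔ₛ′; mk⇔)
open import Function.Properties.Inverse using (↔-refl; ↔-sym)
open import Relation.Nullary using (¬_; Dec; yes; no; does)
open import Relation.Nullary.Decidable using (dec-true; dec-false; isYes≗does; _×-dec_; _⊎-dec_)
open import Relation.Binary.Definitions using (tri<; tri≈; tri>)
open import Relation.Binary.PropositionalEquality
  using (_≡_; _≢_; refl; sym; trans; cong; cong₂; subst; subst₂; ≢-sym)

does⇒ : ∀ {A : Set} (a? : Dec A) → does a? ≡ true → A
does⇒ (yes a) _ = a
does⇒ (no _) ()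

==⇒≡ : ∀ {n} {i j : Fin n} → (i == j) ≡ true → i ≡ j
==⇒≡ {i = i} {j} e = does⇒ (i Finₚ.≟ j) (trans (sym (isYes≗does (i Finₚ.≟ j))) e)

≢⇒==-false : ∀ {n} {i j : Fin n} → i ≢ j → (i == j) ≡ false
≢⇒==-false {i = i} {j} i≢j = trans (isYes≗does (i Finₚ.≟ j)) (dec-false (i Finₚ.≟ j) i≢j)

≡false⇒≢true : ∀ {b} → b ≡ false → b ≢ true
≡false⇒≢true refl ()

∨-trueˡ : ∀ {a} b → a ≡ true → a ∨ b ≡ true
∨-trueˡ b refl = refl

∨-trueʳ : ∀ a {b} → b ≡ true → a ∨ b ≡ true
∨-trueʳ a refl = Boolₚ.∨-zeroʳ a

∨-true⇒⊎ : ∀ a {b} → a ∨ b ≡ true → a ≡ true ⊎ b ≡ true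
∨-true⇒⊎ true _ = inj₁ refl
∨-true⇒⊎ false e = inj₂ e

module _ {n} (r : Fin n → Fin n → Bool) where

  adj-simple⇒ : ∀ i j → Adj (simple r) i j → r i j ≡ true ⊎ r j i ≡ true
  adj-simple⇒ i j e = ∨-true⇒⊎ (r i j) (Boolₚ.∧-conicalʳ _ _ e)

  adj-simple-true : ∀ {i j} → i ≢ j → r i j ≡ true → Adj (simple r) i j
  adj-simple-true i≢j e rewrite ≢⇒==-false i≢j | e = refl

  adj-simple-false : ∀ i j → r i j ≡ false → r j i ≡ false → adj (simple r) i j ≡ false
  adj-simple-false i j e e′ rewrite e | e′ = Boolₚ.∧-zeroʳ (not (i == j))

  adj-simple-≗ : (G : Graph n) → (∀ i j → r i j ≡ adj G i j) →
                 ∀ i j → adj (simple r) i j ≡ adj G i j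
  adj-simple-≗ G r≗G i j rewrite r≗G i j | r≗G j i | adj-sym G j i with i Finₚ.≟ j
  ... | yes refl rewrite adj-irrefl G i = refl
  ... | no _ = Boolₚ.∨-idem (adj G i j)

module _ {k p} (f : Fin k → Maybe (Fin p)) (r : Fin p → Fin p → Bool) where

  pull-just : ∀ i j {a b} → f i ≡ just a → f j ≡ just b → pull f r i j ≡ r a b
  pull-just i j fi fj with f i | f j
  pull-just i j refl refl | just a | just b = refl

  pull-nothingˡ : ∀ i j → f i ≡ nothing → pull f r i j ≡ false
  pull-nothingˡ i j fi with f i | f j
  pull-nothingˡ i j () | just _ | just _
  ... | just _ | nothing = refl
  ... | nothing | _ = refl

  pull-nothingʳ : ∀ i j → f j ≡ nothing → pull f r i j ≡ false
  pull-nothingʳ i j fj with f i | f j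
  pull-nothingʳ i j () | just _ | just _
  ... | just _ | nothing = refl
  ... | nothing | _ = refl

pull-K₁ : ∀ {k} (f : Fin k → Maybe (Fin 1)) (H : Graph 1) i j → pull f (adj H) i j ≡ false
pull-K₁ f H i j with f i | f j
... | just zero | just zero = adj-irrefl H zero
... | just zero | nothing = refl
... | nothing | _ = refl

-- Sums of graphs

data Side (n : ℕ) {m : ℕ} : Fin (n + m) → Set where
  left  : (a : Fin n) → Side n (a ↑ˡ m)
  right : (b : Fin m) → Side n (n ↑ʳ b)

side : ∀ n {m} (i : Fin (n + m)) → Side n i
side n i with splitAt n i in eq
... | inj₁ a = subst (Side n) (Finₚ.splitAt⁻¹-↑ˡ eq) (left a)
... | inj₂ b = subst (Side n) (Finₚ.splitAt⁻¹-↑ʳ eq) (right b)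

module _ (n : ℕ) {m : ℕ} where

  leftPart-↑ˡ : ∀ a → leftPart n (a ↑ˡ m) ≡ just a
  leftPart-↑ˡ a rewrite Finₚ.splitAt-↑ˡ n a m = refl

  leftPart-↑ʳ : ∀ b → leftPart n (n ↑ʳ b) ≡ nothing
  leftPart-↑ʳ b rewrite Finₚ.splitAt-↑ʳ n m b = refl

  rightPart-↑ˡ : ∀ a → rightPart n (a ↑ˡ m) ≡ nothing
  rightPart-↑ˡ a rewrite Finₚ.splitAt-↑ˡ n a m = refl

  crossing-↑ˡ-↑ʳ : ∀ a b → crossing n (a ↑ˡ m) (n ↑ʳ b) ≡ true
  crossing-↑ˡ-↑ʳ a b rewrite Finₚ.splitAt-↑ˡ n a m | Finₚ.splitAt-↑ʳ n m b = refl

  ↑ˡ≢↑ʳ : ∀ a b → a ↑ˡ m ≢ n ↑ʳ b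
  ↑ˡ≢↑ʳ a b e
    with trans (sym (Finₚ.splitAt-↑ˡ n a m)) (trans (cong (splitAt n) e) (Finₚ.splitAt-↑ʳ n m b))
  ... | ()

  isLeft : Fin (n + m) → Bool
  isLeft i = is-just (leftPart n i)

  isLeft-↑ˡ : ∀ a → isLeft (a ↑ˡ m) ≡ true
  isLeft-↑ˡ a = cong is-just (leftPart-↑ˡ a)

  isLeft-↑ʳ : ∀ b → isLeft (n ↑ʳ b) ≡ false
  isLeft-↑ʳ b = cong is-just (leftPart-↑ʳ b)

  left-right : (P : Fin (n + m) → Fin (n + m) → Set) → (∀ a b → P (a ↑ˡ m) (n ↑ʳ b)) →
               ∀ {u v} → isLeft u ≡ true → isLeft v ≡ false → P u v
  left-right P P-left-right {u} {v} lu lv with side n u | side n v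
  ... | left a  | right b  = P-left-right a b
  ... | left _  | left a   = ⊥-elim (≡false⇒≢true lv (isLeft-↑ˡ a))
  ... | right b | _        = ⊥-elim (≡false⇒≢true (isLeft-↑ʳ b) lu)

module _ (n : ℕ) {m : ℕ} (u : Fin (suc n)) (v : Fin (suc m)) where

  oneRight-↑ˡ : ∀ a → a ≢ u → oneRight n u v (a ↑ˡ m) ≡ nothing
  oneRight-↑ˡ a a≢u rewrite Finₚ.splitAt-↑ˡ (suc n) a m | ≢⇒==-false a≢u = refl

  oneRight-glued : oneRight n u v (u ↑ˡ m) ≡ just v
  oneRight-glued rewrite Finₚ.splitAt-↑ˡ (suc n) u m | ==-refl u = refl

  oneRight-↑ʳ : ∀ b → oneRight n u v (suc n ↑ʳ b) ≡ just (punchIn v b)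
  oneRight-↑ʳ b rewrite Finₚ.splitAt-↑ʳ (suc n) m b = refl

module _ {n m} (G : Graph n) (H : Graph m) where

  private
    sum-rel : Fin (n + m) → Fin (n + m) → Bool
    sum-rel i j = pull (leftPart n) (adj G) i j ∨ pull (rightPart n) (adj H) i j

    join-rel : Fin (n + m) → Fin (n + m) → Bool
    join-rel i j = pull (leftPart n) (adj G) i j ∨ pull (rightPart n) (adj H) i j ∨ crossing n i j

  ⊕-left-right : ∀ a b → adj (G ⊕ H) (a ↑ˡ m) (n ↑ʳ b) ≡ false
  ⊕-left-right a b = adj-simple-false sum-rel (a ↑ˡ m) (n ↑ʳ b)
    (cong₂ _∨_ (pull-nothingʳ (leftPart n) (adj G) (a ↑ˡ m) (n ↑ʳ b) (leftPart-↑ʳ n b))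
               (pull-nothingˡ (rightPart n) (adj H) (a ↑ˡ m) (n ↑ʳ b) (rightPart-↑ˡ n a)))
    (cong₂ _∨_ (pull-nothingˡ (leftPart n) (adj G) (n ↑ʳ b) (a ↑ˡ m) (leftPart-↑ʳ n b))
               (pull-nothingʳ (rightPart n) (adj H) (n ↑ʳ b) (a ↑ˡ m) (rightPart-↑ˡ n a)))

  ⊗-left-right : ∀ a b → Adj (G ⊗ H) (a ↑ˡ m) (n ↑ʳ b)
  ⊗-left-right a b = adj-simple-true join-rel (↑ˡ≢↑ʳ n a b)
    (∨-trueʳ (pull (leftPart n) (adj G) _ _) (∨-trueʳ (pull (rightPart n) (adj H) _ _)
      (crossing-↑ˡ-↑ʳ n a b)))

module _ {n m} (G : Graph (suc n)) (H : Graph (suc m)) (u : Fin (suc n)) (v : Fin (suc m)) where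

  oneSum-rel : Fin (suc n + m) → Fin (suc n + m) → Bool
  oneSum-rel i j = pull (oneLeft n) (adj G) i j ∨ pull (oneRight n u v) (adj H) i j

  oneSum-left-right : ∀ a b → a ≢ u → adj (oneSum G H u v) (a ↑ˡ m) (suc n ↑ʳ b) ≡ false
  oneSum-left-right a b a≢u = adj-simple-false oneSum-rel (a ↑ˡ m) (suc n ↑ʳ b)
    (cong₂ _∨_ (pull-nothingʳ (oneLeft n) (adj G) (a ↑ˡ m) (suc n ↑ʳ b) (leftPart-↑ʳ (suc n) b))
               (pull-nothingˡ (oneRight n u v) (adj H) (a ↑ˡ m) (suc n ↑ʳ b) (oneRight-↑ˡ n u v a a≢u)))
    (cong₂ _∨_ (pull-nothingˡ (oneLeft n) (adj G) (suc n ↑ʳ b) (a ↑ˡ m) (leftPart-↑ʳ (suc n) b))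
               (pull-nothingʳ (oneRight n u v) (adj H) (suc n ↑ʳ b) (a ↑ˡ m) (oneRight-↑ˡ n u v a a≢u)))

oneSum-K₁ʳ : ∀ {n} (G : Graph (suc n)) (H : Graph 1) u v → G ≅ oneSum G H u v
oneSum-K₁ʳ {n} G H u v = mk↔ₛ′ (_↑ˡ 0) forget ↑ˡ-forget forget-↑ˡ , λ a b →
  trans (adj-simple-≗ (oneSum-rel G H u v) (induced G forget) rel≗ (a ↑ˡ 0) (b ↑ˡ 0))
        (cong₂ (adj G) (forget-↑ˡ a) (forget-↑ˡ b))
  where
  forget : Fin (suc n + 0) → Fin (suc n)
  forget i = [ id , (λ ()) ]′ (splitAt (suc n) i)

  forget-↑ˡ : ∀ a → forget (a ↑ˡ 0) ≡ a
  forget-↑ˡ a rewrite Finₚ.splitAt-↑ˡ (suc n) a 0 = refl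

  ↑ˡ-forget : ∀ i → forget i ↑ˡ 0 ≡ i
  ↑ˡ-forget i with splitAt (suc n) i in eq
  ... | inj₁ a = Finₚ.splitAt⁻¹-↑ˡ eq

  oneLeft-forget : ∀ i → oneLeft n i ≡ just (forget i)
  oneLeft-forget i with splitAt (suc n) i
  ... | inj₁ a = refl

  rel≗ : ∀ i j → oneSum-rel G H u v i j ≡ adj G (forget i) (forget j)
  rel≗ i j = trans (cong₂ _∨_ (pull-just (oneLeft n) (adj G) i j (oneLeft-forget i) (oneLeft-forget j))
                              (pull-K₁ (oneRight n u v) H i j))
                   (Boolₚ.∨-identityʳ _)

oneSum-K₁ˡ : ∀ {m} (G : Graph 1) (H : Graph (suc m)) v → H ≅ oneSum G H zero v
oneSum-K₁ˡ {m} G H v = mk↔ₛ′ to from to-from from-to , λ a b →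
  trans (adj-simple-≗ (oneSum-rel G H zero v) (induced H from) rel≗ (to a) (to b))
        (cong₂ (adj H) (from-to a) (from-to b))
  where
  from : Fin (1 + m) → Fin (suc m)
  from zero = v
  from (suc b) = punchIn v b

  to : Fin (suc m) → Fin (1 + m)
  to j with j Finₚ.≟ v
  ... | yes _ = zero
  ... | no j≢v = suc (punchOut (j≢v ∘ sym))

  from-to : ∀ j → from (to j) ≡ j
  from-to j with j Finₚ.≟ v
  ... | yes refl = refl
  ... | no j≢v = Finₚ.punchIn-punchOut (j≢v ∘ sym)

  to-from : ∀ i → to (from i) ≡ i
  to-from zero with v Finₚ.≟ v
  ... | yes _ = refl
  ... | no v≢v = ⊥-elim (v≢v refl)
  to-from (suc b) with punchIn v b Finₚ.≟ v
  ... | yes e = ⊥-elim (Finₚ.punchInᵢ≢i v b e)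
  ... | no _ = cong suc (trans (Finₚ.punchOut-cong v refl) (Finₚ.punchOut-punchIn v))

  oneRight-from : ∀ i → oneRight 0 zero v i ≡ just (from i)
  oneRight-from zero = refl
  oneRight-from (suc b) = refl

  rel≗ : ∀ i j → oneSum-rel G H zero v i j ≡ adj H (from i) (from j)
  rel≗ i j = cong₂ _∨_ (pull-K₁ (oneLeft 0) G i j)
                       (pull-just (oneRight 0 zero v) (adj H) i j (oneRight-from i) (oneRight-from j))

-- Indecomposable graphs

PairAcross : ∀ {n} → Graph n → (Fin n → Set) → (Fin n → Bool) → Bool → Set
PairAcross {n} G Q p b =
  Σ (Fin n) λ u → Σ (Fin n) λ v → Q u × Q v × p u ≡ true × p v ≡ false × adj G u v ≡ b

-- Vertex sets are given by Boolean colourings p, and p splits the graph when both colours occur.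
record Indecomposable {n} (G : Graph n) : Set where
  field
    two-vertices  : Σ (Fin n) λ i → Σ (Fin n) λ j → i ≢ j
    connected     : ∀ p {i j} → p i ≡ true → p j ≡ false → PairAcross G (λ _ → ⊤) p true
    co-connected  : ∀ p {i j} → p i ≡ true → p j ≡ false → PairAcross G (λ _ → ⊤) p false
    no-cut-vertex : ∀ c p {i j} → i ≢ c → j ≢ c → p i ≡ true → p j ≡ false →
                    PairAcross G (_≢ c) p true
open Indecomposable

≅-adj-from : ∀ {n m} {G : Graph n} {H : Graph m} (G≅H : G ≅ H) →
             ∀ u v → adj G (Inverse.from (proj₁ G≅H) u) (Inverse.from (proj₁ G≅H) v) ≡ adj H u v
≅-adj-from {G = G} {H} (f , f-adj) u v =
  trans (sym (f-adj (from u) (from v))) (cong₂ (adj H) (strictlyInverseˡ u) (strictlyInverseˡ v))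
  where open Inverse f

≅-sym : ∀ {n m} {G : Graph n} {H : Graph m} → G ≅ H → H ≅ G
≅-sym {G = G} {H} G≅H = ↔-sym (proj₁ G≅H) , ≅-adj-from {G = G} {H} G≅H

indecomposable-≅ : ∀ {n m} {G : Graph n} {H : Graph m} → G ≅ H → Indecomposable H → Indecomposable G
indecomposable-≅ {G = G} {H} (f , f-adj) ind = record
  { two-vertices  = let i , j , i≢j = two-vertices ind in from i , from j , i≢j ∘ from-injective
  ; connected     = λ p pi pj → pullback _ (connected ind (p ∘ from) (p-to p pi) (p-to p pj))
  ; co-connected  = λ p pi pj → pullback _ (co-connected ind (p ∘ from) (p-to p pi) (p-to p pj))
  ; no-cut-vertex = λ c p i≢c j≢c pi pj → pullback (λ u≢c → u≢c ∘ from≡⇒≡to)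
      (no-cut-vertex ind (to c) (p ∘ from) (i≢c ∘ to-injective) (j≢c ∘ to-injective)
                     (p-to p pi) (p-to p pj))
  }
  where
  open Inverse f

  from≡⇒≡to : ∀ {u c} → from u ≡ c → u ≡ to c
  from≡⇒≡to {u} refl = sym (strictlyInverseˡ u)

  from-injective : ∀ {u v} → from u ≡ from v → u ≡ v
  from-injective e = trans (from≡⇒≡to e) (strictlyInverseˡ _)

  to-injective : ∀ {i j} → to i ≡ to j → i ≡ j
  to-injective e = trans (sym (strictlyInverseʳ _)) (trans (cong from e) (strictlyInverseʳ _))

  p-to : ∀ (p : Fin _ → Bool) {i b} → p i ≡ b → p (from (to i)) ≡ b
  p-to p {i} e = trans (cong p (strictlyInverseʳ i)) e

  pullback : ∀ {Q Q′ p b} → (∀ {u} → Q u → Q′ (from u)) →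
             PairAcross H Q (p ∘ from) b → PairAcross G Q′ p b
  pullback QQ′ (u , v , qu , qv , pu , pv , e) =
    from u , from v , QQ′ qu , QQ′ qv , pu , pv , trans (≅-adj-from {G = G} {H} (f , f-adj) u v) e

sesqui-vertex : ∀ {n} {G : Graph n} → Sesqui G → Fin n
sesqui-vertex k₁ = zero
sesqui-vertex (iso s (f , _)) = Inverse.to f (sesqui-vertex s)
sesqui-vertex (sum₀ {m = m} s _) = sesqui-vertex s ↑ˡ m
sesqui-vertex (join {m = m} s _) = sesqui-vertex s ↑ˡ m
sesqui-vertex (sum₁ _ _ _ _) = zero

sesqui⇒¬indecomposable : ∀ {n} {G : Graph n} → Sesqui G → ¬ Indecomposable G
sesqui⇒¬indecomposable k₁ ind with two-vertices ind
... | zero , zero , 0≢0 = 0≢0 refl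
sesqui⇒¬indecomposable (iso s G≅H) ind = sesqui⇒¬indecomposable s (indecomposable-≅ G≅H ind)
sesqui⇒¬indecomposable (sum₀ {n} {m} {G} {H} s t) ind
  with u , v , _ , _ , pu , pv , e ←
         connected ind (isLeft n) (isLeft-↑ˡ n (sesqui-vertex s)) (isLeft-↑ʳ n (sesqui-vertex t))
  = ≡false⇒≢true (left-right n (λ u v → adj (G ⊕ H) u v ≡ false) (⊕-left-right G H) pu pv) e
sesqui⇒¬indecomposable (join {n} {m} {G} {H} s t) ind
  with u , v , _ , _ , pu , pv , e ←
         co-connected ind (isLeft n) (isLeft-↑ˡ n (sesqui-vertex s)) (isLeft-↑ʳ n (sesqui-vertex t))
  = ≡false⇒≢true e (left-right n (λ u v → Adj (G ⊗ H) u v) (⊗-left-right G H) pu pv)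
sesqui⇒¬indecomposable (sum₁ {m = zero} {G} {H} u v s _) ind =
  sesqui⇒¬indecomposable s (indecomposable-≅ (oneSum-K₁ʳ G H u v) ind)
sesqui⇒¬indecomposable (sum₁ {zero} {suc m} {G} {H} zero v _ t) ind =
  sesqui⇒¬indecomposable t (indecomposable-≅ (oneSum-K₁ˡ G H v) ind)
-- The glued vertex u ↑ˡ suc m separates the other vertices of G from those of H.
sesqui⇒¬indecomposable (sum₁ {suc n} {suc m} {G} {H} u v _ _) ind
  with a , b , a≢c , _ , pa , pb , e ← no-cut-vertex ind (u ↑ˡ suc m) (isLeft (suc (suc n)))
         (Finₚ.punchInᵢ≢i u zero ∘ Finₚ.↑ˡ-injective (suc m) (punchIn u zero) u)
         (↑ˡ≢↑ʳ (suc (suc n)) u zero ∘ sym)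
         (isLeft-↑ˡ (suc (suc n)) (punchIn u zero)) (isLeft-↑ʳ (suc (suc n)) zero)
  = ≡false⇒≢true (left-right (suc (suc n)) (λ a b → a ≢ u ↑ˡ suc m → adj (oneSum G H u v) a b ≡ false)
      (λ α β α↑≢u↑ → oneSum-left-right G H u v α β (α↑≢u↑ ∘ cong (_↑ˡ suc m))) pa pb a≢c) e

-- Long cycles

pairAcross-of-edge : ∀ {k} (G : Graph k) p (Q : Fin k → Set) {x y} → Q x → Q y →
                     p x ≢ p y → Adj G x y → PairAcross G Q p true
pairAcross-of-edge G p Q {x} {y} qx qy px≢py e with p x in px | p y in py
... | true  | false = x , y , qx , qy , px , py , e
... | false | true  = y , x , qy , qx , py , px , trans (adj-sym G y x) e
... | true  | true  = ⊥-elim (px≢py refl)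
... | false | false = ⊥-elim (px≢py refl)

nonAdjacentPair-via : ∀ {n} (G : Graph n) p {i j c} → p i ≡ true → p j ≡ false →
  adj G c i ≡ false → adj G c j ≡ false → PairAcross G (λ _ → ⊤) p false
nonAdjacentPair-via G p {i} {j} {c} pi pj ci cj with p c in pc
... | true  = c , j , tt , tt , pc , pj , cj
... | false = i , c , tt , tt , pi , pc , trans (adj-sym G i c) ci

CycleStep : ℕ → ℕ → ℕ → Set
CycleStep k a b = suc a ≡ b ⊎ (suc a ≡ k × b ≡ 0)

cycleStep? : ∀ k a b → Dec (CycleStep k a b)
cycleStep? k a b = (suc a ℕ.≟ b) ⊎-dec ((suc a ℕ.≟ k) ×-dec (b ℕ.≟ 0))

CycleEdge : ℕ → ℕ → ℕ → Set
CycleEdge k a b = CycleStep k a b ⊎ CycleStep k b a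

module _ {k : ℕ} where

  private
    cycle-rel : Fin k → Fin k → Bool
    cycle-rel i j = does (cycleStep? k (toℕ i) (toℕ j))

  adj-Cycle⇒edge : ∀ i j → Adj (Cycle k) i j → CycleEdge k (toℕ i) (toℕ j)
  adj-Cycle⇒edge i j e with adj-simple⇒ cycle-rel i j e
  ... | inj₁ ij = inj₁ (does⇒ (cycleStep? k _ _) ij)
  ... | inj₂ ji = inj₂ (does⇒ (cycleStep? k _ _) ji)

  step⇒≢ : 2 ≤ k → ∀ {a b} → CycleStep k a b → a ≢ b
  step⇒≢ _ (inj₁ refl) a≡1+a = 1+n≢n (sym a≡1+a)
  step⇒≢ (s≤s (s≤s _)) (inj₂ (() , refl)) refl

  step⇒adj-Cycle : 2 ≤ k → ∀ i j → CycleStep k (toℕ i) (toℕ j) → Adj (Cycle k) i j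
  step⇒adj-Cycle k≥2 i j s =
    adj-simple-true cycle-rel (step⇒≢ k≥2 s ∘ cong toℕ) (dec-true (cycleStep? k _ _) s)

  edge⇒adj-Cycle : 2 ≤ k → ∀ i j → CycleEdge k (toℕ i) (toℕ j) → Adj (Cycle k) i j
  edge⇒adj-Cycle k≥2 i j (inj₁ s) = step⇒adj-Cycle k≥2 i j s
  edge⇒adj-Cycle k≥2 i j (inj₂ s) = trans (adj-sym (Cycle k) i j) (step⇒adj-Cycle k≥2 j i s)

  ¬edge⇒¬adj-Cycle : ∀ i j → ¬ CycleEdge k (toℕ i) (toℕ j) → adj (Cycle k) i j ≡ false
  ¬edge⇒¬adj-Cycle i j ¬e = adj-simple-false cycle-rel i j
    (dec-false (cycleStep? k _ _) (¬e ∘ inj₁)) (dec-false (cycleStep? k _ _) (¬e ∘ inj₂))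

  -- p, extended by false beyond k, so that change-point can walk along ℕ.
  onℕ : (Fin k → Bool) → ℕ → Bool
  onℕ p t with t ℕ.<? k
  ... | yes t<k = p (fromℕ< t<k)
  ... | no _ = false

  onℕ-fromℕ< : ∀ p {t} (t<k : t < k) → onℕ p t ≡ p (fromℕ< t<k)
  onℕ-fromℕ< p {t} t<k with t ℕ.<? k
  ... | yes _ = refl
  ... | no t≮k = ⊥-elim (t≮k t<k)

  onℕ-toℕ : ∀ p i → onℕ p (toℕ i) ≡ p i
  onℕ-toℕ p i = trans (onℕ-fromℕ< p (Finₚ.toℕ<n i)) (cong p (Finₚ.fromℕ<-toℕ i (Finₚ.toℕ<n i)))

  onℕ-≢ : ∀ p {i j} → p i ≡ true → p j ≡ false → onℕ p (toℕ i) ≢ onℕ p (toℕ j)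
  onℕ-≢ p {i} {j} pi pj e =
    ≡false⇒≢true pj (trans (sym (onℕ-toℕ p j)) (trans (sym e) (trans (onℕ-toℕ p i) pi)))

change-point : (g : ℕ → Bool) (s d : ℕ) → g s ≢ g (s + d) →
               Σ ℕ λ t → s ≤ t × suc t ≤ s + d × g t ≢ g (suc t)
change-point g s zero ne = ⊥-elim (ne (cong g (sym (+-identityʳ s))))
change-point g s (suc d) ne with g s Boolₚ.≟ g (suc s)
... | no gs≢gs+1 = s , ≤-refl , subst (suc s ≤_) (sym (+-suc s d)) (s≤s (m≤m+n s d)) , gs≢gs+1
... | yes gs≡gs+1
  with t , s<t , t<e , gt≢gt+1 ←
         change-point g (suc s) d (λ e → ne (trans gs≡gs+1 (trans e (cong g (sym (+-suc s d))))))
  = t , ≤-trans (n≤1+n s) s<t , subst (suc t ≤_) (sym (+-suc s d)) t<e , gt≢gt+1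

pairAcross-in-arc : ∀ {k} → 2 ≤ k → (p : Fin k → Bool) (Q : Fin k → Set) → ∀ {s e} → s ≤ e → e < k →
  onℕ p s ≢ onℕ p e → (∀ x → s ≤ toℕ x → toℕ x ≤ e → Q x) → PairAcross (Cycle k) Q p true
pairAcross-in-arc {k} k≥2 p Q {s} {e} s≤e e<k ps≢pe Q-arc
  with t , s≤t , t<e , pt≢pt+1 ←
         change-point (onℕ p) s (e ∸ s) (subst (λ z → onℕ p s ≢ onℕ p z) (sym (m+[n∸m]≡n s≤e)) ps≢pe)
  = pairAcross-of-edge (Cycle k) p Q
      (Q-arc x (subst (s ≤_) (sym tx) s≤t) (subst (_≤ e) (sym tx) (≤-trans (n≤1+n t) t+1≤e)))
      (Q-arc y (subst (s ≤_) (sym ty) (≤-trans s≤t (n≤1+n t))) (subst (_≤ e) (sym ty) t+1≤e))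
      (λ px≡py → pt≢pt+1 (trans (onℕ-fromℕ< p t<k) (trans px≡py (sym (onℕ-fromℕ< p t+1<k)))))
      (step⇒adj-Cycle k≥2 x y (inj₁ (trans (cong suc tx) (sym ty))))
  where
  t+1≤e : suc t ≤ e
  t+1≤e = subst (suc t ≤_) (m+[n∸m]≡n s≤e) t<e
  t+1<k : suc t < k
  t+1<k = ≤-<-trans t+1≤e e<k
  t<k : t < k
  t<k = <-trans (n<1+n t) t+1<k
  x y : Fin k
  x = fromℕ< t<k
  y = fromℕ< t+1<k
  tx : toℕ x ≡ t
  tx = Finₚ.toℕ-fromℕ< t<k
  ty : toℕ y ≡ suc t
  ty = Finₚ.toℕ-fromℕ< t+1<k

module _ (k′ : ℕ) where

  private
    K last : ℕ
    K = 5 + k′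
    last = 4 + k′

    K≥2 : 2 ≤ K
    K≥2 = s≤s (s≤s z≤n)

  ¬edge-+2 : ∀ c → ¬ CycleEdge K c (2 + c)
  ¬edge-+2 c (inj₁ (inj₁ e)) = 1+n≢n (sym (suc-injective e))
  ¬edge-+2 c (inj₁ (inj₂ (_ , ())))
  ¬edge-+2 c (inj₂ (inj₁ e)) = m≢1+n+m c (sym e)
  ¬edge-+2 .zero (inj₂ (inj₂ (() , refl)))

  ¬edge-+3 : ∀ c → ¬ CycleEdge K c (3 + c)
  ¬edge-+3 c (inj₁ (inj₁ e)) = m≢1+n+m c (suc-injective e)
  ¬edge-+3 c (inj₁ (inj₂ (_ , ())))
  ¬edge-+3 c (inj₂ (inj₁ e)) = m≢1+n+m c (sym e)
  ¬edge-+3 .zero (inj₂ (inj₂ (() , refl)))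

  far-vertexℕ : ∀ a b → a < K → CycleStep K a b →
                Σ ℕ λ c → c < K × ¬ CycleEdge K c a × ¬ CycleEdge K c b
  far-vertexℕ 0 .1 _ (inj₁ refl) = 3 , s≤s (s≤s (s≤s (s≤s z≤n))) ,
    (λ { (inj₁ (inj₁ ())) ; (inj₁ (inj₂ (() , _))) ; (inj₂ (inj₁ ())) ; (inj₂ (inj₂ (_ , ()))) }) ,
    (λ { (inj₁ (inj₁ ())) ; (inj₁ (inj₂ (_ , ()))) ; (inj₂ (inj₁ ())) ; (inj₂ (inj₂ (_ , ()))) })
  far-vertexℕ 1 .2 _ (inj₁ refl) = 4 , s≤s (s≤s (s≤s (s≤s (s≤s z≤n)))) ,
    (λ { (inj₁ (inj₁ ())) ; (inj₁ (inj₂ (_ , ()))) ; (inj₂ (inj₁ ())) ; (inj₂ (inj₂ (_ , ()))) }) ,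
    (λ { (inj₁ (inj₁ ())) ; (inj₁ (inj₂ (_ , ()))) ; (inj₂ (inj₁ ())) ; (inj₂ (inj₂ (_ , ()))) })
  far-vertexℕ (suc (suc c)) .(3 + c) c+2<K (inj₁ refl) =
    c , <-trans (s≤s (n≤1+n c)) c+2<K , ¬edge-+2 c , ¬edge-+3 c
  far-vertexℕ a .0 _ (inj₂ (a+1≡K , refl)) = 2 , s≤s (s≤s (s≤s z≤n)) , ¬edge-2 a a+1≡K ,
    (λ { (inj₁ (inj₁ ())) ; (inj₁ (inj₂ (() , _))) ; (inj₂ (inj₁ ())) ; (inj₂ (inj₂ (() , _))) })
    where
    ¬edge-2 : ∀ a → suc a ≡ K → ¬ CycleEdge K 2 a
    ¬edge-2 .3 () (inj₁ (inj₁ refl))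
    ¬edge-2 _ _ (inj₁ (inj₂ (() , _)))
    ¬edge-2 .1 () (inj₂ (inj₁ refl))
    ¬edge-2 _ _ (inj₂ (inj₂ (_ , ())))

  far-vertex : ∀ (i j : Fin K) → CycleStep K (toℕ i) (toℕ j) →
               Σ (Fin K) λ c → adj (Cycle K) c i ≡ false × adj (Cycle K) c j ≡ false
  far-vertex i j s with far-vertexℕ (toℕ i) (toℕ j) (Finₚ.toℕ<n i) s
  ... | c , c<K , ¬ci , ¬cj = fromℕ< c<K ,
    ¬edge⇒¬adj-Cycle _ i (subst (λ c → ¬ CycleEdge K c (toℕ i)) (sym (Finₚ.toℕ-fromℕ< c<K)) ¬ci) ,
    ¬edge⇒¬adj-Cycle _ j (subst (λ c → ¬ CycleEdge K c (toℕ j)) (sym (Finₚ.toℕ-fromℕ< c<K)) ¬cj)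

  -- Unless p changes along the arc 0 … u or along the arc v … last, it changes across last — 0.
  wrap-around : ∀ c p {u v} → toℕ u < toℕ c → toℕ c < toℕ v → onℕ p (toℕ u) ≢ onℕ p (toℕ v) →
                PairAcross (Cycle K) (_≢ c) p true
  wrap-around c p {u} {v} u<c c<v pu≢pv
    with onℕ p 0 Boolₚ.≟ onℕ p (toℕ u) | onℕ p (toℕ v) Boolₚ.≟ onℕ p last
  ... | no p0≢pu | _ = pairAcross-in-arc K≥2 p (_≢ c) z≤n (Finₚ.toℕ<n u) p0≢pu
          (λ x _ x≤u → Finₚ.<⇒≢ (≤-<-trans x≤u u<c))
  ... | yes _ | no pv≢plast =
        pairAcross-in-arc K≥2 p (_≢ c) (≤-pred (Finₚ.toℕ<n v)) (n<1+n last) pv≢plast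
          (λ x v≤x _ → ≢-sym (Finₚ.<⇒≢ (<-≤-trans c<v v≤x)))
  ... | yes p0≡pu | yes pv≡plast = pairAcross-of-edge (Cycle K) p (_≢ c)
          (≢-sym (Finₚ.<⇒≢ (subst (toℕ c <_) (sym (Finₚ.toℕ-fromℕ last))
                                  (<-≤-trans c<v (≤-pred (Finₚ.toℕ<n v))))))
          (Finₚ.<⇒≢ (≤-<-trans z≤n u<c))
          (λ e → pu≢pv (trans (sym p0≡pu) (trans (onℕ-toℕ p zero)
                          (trans (sym e) (trans (sym plast) (sym pv≡plast))))))
          (step⇒adj-Cycle K≥2 (fromℕ last) zero (inj₂ (cong suc (Finₚ.toℕ-fromℕ last) , refl)))
    where
    plast : onℕ p last ≡ p (fromℕ last)
    plast = trans (cong (onℕ p) (sym (Finₚ.toℕ-fromℕ last))) (onℕ-toℕ p (fromℕ last))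

  no-cut-vertex-ordered : ∀ c p {u v} → toℕ u ≤ toℕ v → u ≢ c → v ≢ c →
                          onℕ p (toℕ u) ≢ onℕ p (toℕ v) → PairAcross (Cycle K) (_≢ c) p true
  no-cut-vertex-ordered c p {u} {v} u≤v u≢c v≢c pu≢pv
    with <-cmp (toℕ v) (toℕ c) | <-cmp (toℕ u) (toℕ c)
  ... | tri< v<c _ _ | _ = pairAcross-in-arc K≥2 p (_≢ c) u≤v (Finₚ.toℕ<n v) pu≢pv
          (λ x _ x≤v → Finₚ.<⇒≢ (≤-<-trans x≤v v<c))
  ... | tri≈ _ v≡c _ | _ = ⊥-elim (v≢c (Finₚ.toℕ-injective v≡c))
  ... | tri> _ _ _ | tri≈ _ u≡c _ = ⊥-elim (u≢c (Finₚ.toℕ-injective u≡c))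
  ... | tri> _ _ _ | tri> _ _ c<u = pairAcross-in-arc K≥2 p (_≢ c) u≤v (Finₚ.toℕ<n v) pu≢pv
          (λ x u≤x _ → ≢-sym (Finₚ.<⇒≢ (<-≤-trans c<u u≤x)))
  ... | tri> _ _ c<v | tri< u<c _ _ = wrap-around c p u<c c<v pu≢pv

  cycle₅₊-co-connected : ∀ p {i j} → p i ≡ true → p j ≡ false → PairAcross (Cycle K) (λ _ → ⊤) p false
  cycle₅₊-co-connected p {i} {j} pi pj with adj (Cycle K) i j in e
  ... | false = i , j , tt , tt , pi , pj , e
  ... | true with adj-Cycle⇒edge i j e
  ...   | inj₁ s = let c , ci , cj = far-vertex i j s in nonAdjacentPair-via (Cycle K) p pi pj ci cj
  ...   | inj₂ s = let c , cj , ci = far-vertex j i s in nonAdjacentPair-via (Cycle K) p pi pj ci cj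

  cycle₅₊-no-cut-vertex : ∀ c p {i j} → i ≢ c → j ≢ c → p i ≡ true → p j ≡ false →
                          PairAcross (Cycle K) (_≢ c) p true
  cycle₅₊-no-cut-vertex c p {i} {j} i≢c j≢c pi pj with ≤-total (toℕ i) (toℕ j)
  ... | inj₁ i≤j = no-cut-vertex-ordered c p i≤j i≢c j≢c (onℕ-≢ p pi pj)
  ... | inj₂ j≤i = no-cut-vertex-ordered c p j≤i j≢c i≢c (≢-sym (onℕ-≢ p pi pj))

cycle-connected : ∀ {k} → 2 ≤ k → ∀ p {i j} → p i ≡ true → p j ≡ false →
                  PairAcross (Cycle k) (λ _ → ⊤) p true
cycle-connected k≥2 p {i} {j} pi pj with ≤-total (toℕ i) (toℕ j)
... | inj₁ i≤j = pairAcross-in-arc k≥2 p _ i≤j (Finₚ.toℕ<n j) (onℕ-≢ p pi pj) (λ _ _ _ → tt)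
... | inj₂ j≤i = pairAcross-in-arc k≥2 p _ j≤i (Finₚ.toℕ<n i) (≢-sym (onℕ-≢ p pi pj)) (λ _ _ _ → tt)

cycle-indecomposable : ∀ {k} → 5 ≤ k → Indecomposable (Cycle k)
cycle-indecomposable k≥5@(s≤s (s≤s (s≤s (s≤s (s≤s {n = k′} _))))) = record
  { two-vertices  = zero , suc zero , λ ()
  ; connected     = cycle-connected (≤-trans (s≤s (s≤s z≤n)) k≥5)
  ; co-connected  = cycle₅₊-co-connected k′
  ; no-cut-vertex = cycle₅₊-no-cut-vertex k′
  }

-- Counting and enumerating vertices

indicator : Bool → ℕ
indicator b = if b then 1 else 0

count : ∀ {n} → (Fin n → Bool) → ℕ
count {zero} _ = 0
count {suc n} q = indicator (q zero) + count (q ∘ suc)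

sum-map-tabulate : ∀ {A : Set} {n} (q : A → Bool) (g : Fin n → A) →
                   sum (map (indicator ∘ q) (tabulate g)) ≡ count (q ∘ g)
sum-map-tabulate {n = zero} q g = refl
sum-map-tabulate {n = suc n} q g = cong (indicator (q (g zero)) +_) (sum-map-tabulate q (g ∘ suc))

degree≡count : ∀ {n} (G : Graph n) x → degree G x ≡ count (adj G x)
degree≡count G x = sum-map-tabulate (adj G x) id

count-empty : ∀ n → count {n} (λ _ → false) ≡ 0
count-empty zero = refl
count-empty (suc n) = count-empty n

_⊆_ : ∀ {n} → (Fin n → Bool) → (Fin n → Bool) → Set
q ⊆ q′ = ∀ v → q v ≡ true → q′ v ≡ true

count≤n : ∀ {n} (q : Fin n → Bool) → count q ≤ n
count≤n {zero} q = z≤n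
count≤n {suc n} q with q zero
... | true  = s≤s (count≤n (q ∘ suc))
... | false = ≤-trans (count≤n (q ∘ suc)) (n≤1+n n)

count-mono : ∀ {n} {q q′ : Fin n → Bool} → q ⊆ q′ → count q ≤ count q′
count-mono {zero} _ = z≤n
count-mono {suc n} {q} {q′} q⊆q′ with q zero in q0 | q′ zero in q′0
... | true  | true  = s≤s (count-mono (q⊆q′ ∘ suc))
... | false | true  = ≤-trans (count-mono (q⊆q′ ∘ suc)) (n≤1+n _)
... | false | false = count-mono (q⊆q′ ∘ suc)
... | true  | false = ⊥-elim (≡false⇒≢true q′0 (q⊆q′ zero q0))

count-strict : ∀ {n} {q q′ : Fin n → Bool} → q ⊆ q′ → ∀ a → q′ a ≡ true → q a ≡ false →
               count q < count q′
count-strict {suc n} {q} {q′} q⊆q′ zero q′a qa rewrite qa | q′a = s≤s (count-mono (q⊆q′ ∘ suc))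
count-strict {suc n} {q} {q′} q⊆q′ (suc a) q′a qa with q zero in q0 | q′ zero in q′0
... | true  | true  = s≤s (count-strict (q⊆q′ ∘ suc) a q′a qa)
... | false | true  = ≤-trans (count-strict (q⊆q′ ∘ suc) a q′a qa) (n≤1+n _)
... | false | false = count-strict (q⊆q′ ∘ suc) a q′a qa
... | true  | false = ⊥-elim (≡false⇒≢true q′0 (q⊆q′ zero q0))

⊆⇒≗⊎new : ∀ {n} {q q′ : Fin n → Bool} → q ⊆ q′ →
           (∀ v → q′ v ≡ q v) ⊎ ∃ λ v → q′ v ≡ true × q v ≡ false
⊆⇒≗⊎new {n} {q} {q′} q⊆q′ with Finₚ.all? (λ v → q′ v Boolₚ.≟ q v)
... | yes q′≗q = inj₁ q′≗q
... | no q′≉q with Finₚ.¬∀⟶∃¬ n _ (λ v → q′ v Boolₚ.≟ q v) q′≉q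
...   | v , q′v≢qv with q v in qv
...     | true  = ⊥-elim (q′v≢qv (q⊆q′ v qv))
...     | false with q′ v in q′v
...       | true  = inj₂ (v , q′v , qv)
...       | false = ⊥-elim (q′v≢qv refl)

three≤count : ∀ {n} (q : Fin n → Bool) {a b c} → a ≢ b → a ≢ c → b ≢ c →
              q a ≡ true → q b ≡ true → q c ≡ true → 3 ≤ count q
three≤count {n} q {a} {b} {c} a≢b a≢c b≢c qa qb qc = begin
  3                                     ≡⟨ cong (3 +_) (sym (count-empty n)) ⟩
  3 + count {n} (λ _ → false)           ≤⟨ s≤s (s≤s (count-strict ∅⊆s₁ a (==-refl a) refl)) ⟩
  2 + count s₁                          ≤⟨ s≤s (count-strict s₁⊆s₂ b (∨-trueʳ (b == a) (==-refl b))
                                                             (≢⇒==-false (≢-sym a≢b))) ⟩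
  1 + count s₂                          ≤⟨ count-strict s₂⊆s₃ c (∨-trueʳ (s₂ c) (==-refl c))
                                             (cong₂ _∨_ (≢⇒==-false (≢-sym a≢c)) (≢⇒==-false (≢-sym b≢c))) ⟩
  count s₃                              ≤⟨ count-mono s₃⊆q ⟩
  count q                               ∎
  where
  open ≤-Reasoning

  s₁ s₂ s₃ : Fin n → Bool
  s₁ i = i == a
  s₂ i = s₁ i ∨ i == b
  s₃ i = s₂ i ∨ i == c

  ∅⊆s₁ : (λ _ → false) ⊆ s₁
  ∅⊆s₁ _ ()

  s₁⊆s₂ : s₁ ⊆ s₂
  s₁⊆s₂ i = ∨-trueˡ (i == b)

  s₂⊆s₃ : s₂ ⊆ s₃
  s₂⊆s₃ i = ∨-trueˡ (i == c)

  s₃⊆q : s₃ ⊆ q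
  s₃⊆q i e with ∨-true⇒⊎ (s₂ i) e
  ... | inj₂ i=c = subst (λ v → q v ≡ true) (sym (==⇒≡ i=c)) qc
  ... | inj₁ e′ with ∨-true⇒⊎ (s₁ i) e′
  ...   | inj₁ i=a = subst (λ v → q v ≡ true) (sym (==⇒≡ i=a)) qa
  ...   | inj₂ i=b = subst (λ v → q v ≡ true) (sym (==⇒≡ i=b)) qb

degree-2-neighbours : ∀ {n} (G : Graph n) {x a b} → degree G x ≡ 2 → Adj G x a → Adj G x b → a ≢ b →
                      ∀ v → Adj G x v → v ≡ a ⊎ v ≡ b
degree-2-neighbours G {x} {a} {b} deg xa xb a≢b v xv with v Finₚ.≟ a | v Finₚ.≟ b
... | yes v≡a | _ = inj₁ v≡a
... | no _ | yes v≡b = inj₂ v≡b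
... | no v≢a | no v≢b with subst (3 ≤_) (trans (sym (degree≡count G x)) deg)
                                 (three≤count (adj G x) a≢b (≢-sym v≢a) (≢-sym v≢b) xa xb xv)
...   | s≤s (s≤s ())

enumerate : ∀ {n} (q : Fin n → Bool) → Fin (count q) → Fin n
enumerate {suc n} q i with q zero
enumerate {suc n} q zero    | true  = zero
enumerate {suc n} q (suc i) | true  = suc (enumerate (q ∘ suc) i)
enumerate {suc n} q i       | false = suc (enumerate (q ∘ suc) i)

enumerate-∈ : ∀ {n} (q : Fin n → Bool) i → q (enumerate q i) ≡ true
enumerate-∈ {suc n} q i with q zero in q0
enumerate-∈ {suc n} q zero    | true  = q0
enumerate-∈ {suc n} q (suc i) | true  = enumerate-∈ (q ∘ suc) i
enumerate-∈ {suc n} q i       | false = enumerate-∈ (q ∘ suc) i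

enumerate-injective : ∀ {n} (q : Fin n → Bool) → Injective (enumerate q)
enumerate-injective {suc n} q i j e with q zero
enumerate-injective {suc n} q zero    zero    e  | true = refl
enumerate-injective {suc n} q (suc i) (suc j) e  | true =
  cong suc (enumerate-injective (q ∘ suc) i j (Finₚ.suc-injective e))
enumerate-injective {suc n} q i j e | false = enumerate-injective (q ∘ suc) i j (Finₚ.suc-injective e)

enumerate-surjective : ∀ {n} (q : Fin n → Bool) v → q v ≡ true → ∃ λ i → enumerate q i ≡ v
enumerate-surjective {suc n} q v qv with q zero in q0
enumerate-surjective {suc n} q zero    qv | true = zero , refl
enumerate-surjective {suc n} q (suc v) qv | true =
  let i , e = enumerate-surjective (q ∘ suc) v qv in suc i , cong suc e
enumerate-surjective {suc n} q zero    qv | false = ⊥-elim (≡false⇒≢true q0 qv)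
enumerate-surjective {suc n} q (suc v) qv | false =
  let i , e = enumerate-surjective (q ∘ suc) v qv in i , cong suc e

injective-missing⇒< : ∀ {k n} (f : Fin k → Fin n) → Injective f → ∀ t → (∀ i → f i ≢ t) → k < n
injective-missing⇒< {k} {suc n} f f-inj t f≢t = s≤s (Finₚ.injective⇒≤ {f = g} g-inj)
  where
  g : Fin k → Fin n
  g i = punchOut (≢-sym (f≢t i))

  g-inj : ∀ {i j} → g i ≡ g j → i ≡ j
  g-inj {i} {j} e = f-inj i j (Finₚ.punchOut-injective (≢-sym (f≢t i)) (≢-sym (f≢t j)) e)

injective⇒surjective : ∀ {k n} (f : Fin k → Fin n) → Injective f → n ≤ k → ∀ t → ∃ λ i → f i ≡ t
injective⇒surjective f f-inj n≤k t with Finₚ.any? (λ i → f i Finₚ.≟ t)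
... | yes hit = hit
... | no miss = ⊥-elim (<⇒≱ (injective-missing⇒< f f-inj t (λ i e → miss (i , e))) n≤k)

≅-of-bijection : ∀ {p q} {H : Graph p} (G : Graph q) (h : Fin p → Fin q) → Injective h →
                 (∀ t → ∃ λ i → h i ≡ t) → (∀ i j → adj G (h i) (h j) ≡ adj H i j) → H ≅ G
≅-of-bijection G h h-inj h-surj h-adj =
  mk↔ₛ′ h (proj₁ ∘ h-surj) (proj₂ ∘ h-surj) (λ i → h-inj _ _ (proj₂ (h-surj (h i)))) , h-adj

-- Minimal non-sesquicographs

-- G is the 1-sum of G[x ∷ L] and G[x ∷ R] glued at their vertex zero, which is x in both;
-- toG lists x, then L, then R, in the vertex order of oneSum.
module CutVertexSplit {n} (G : Graph n) (x : Fin n) (L : Fin n → Bool) (L-x : L x ≡ false)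
  (L↛R : ∀ u v → L u ≡ true → L v ≡ false → v ≢ x → adj G u v ≡ false) where

  R : Fin n → Bool
  R v = not (L v) ∧ not (v == x)

  R⇒ : ∀ {v} → R v ≡ true → L v ≡ false × v ≢ x
  R⇒ {v} e with L v | v Finₚ.≟ x
  R⇒ () | true | _
  R⇒ () | false | yes _
  ... | false | no v≢x = refl , v≢x

  toL : Fin (suc (count L)) → Fin n
  toL = x ∷ enumerate L

  toR : Fin (suc (count R)) → Fin n
  toR = x ∷ enumerate R

  A : Graph (suc (count L))
  A = induced G toL

  B : Graph (suc (count R))
  B = induced G toR

  toL-injective : Injective toL
  toL-injective zero    zero    _ = refl
  toL-injective zero    (suc j) e =
    ⊥-elim (≡false⇒≢true L-x (subst (λ v → L v ≡ true) (sym e) (enumerate-∈ L j)))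
  toL-injective (suc i) zero    e = sym (toL-injective zero (suc i) (sym e))
  toL-injective (suc i) (suc j) e = cong suc (enumerate-injective L i j e)

  toR-injective : Injective toR
  toR-injective zero    zero    _ = refl
  toR-injective zero    (suc j) e = ⊥-elim (proj₂ (R⇒ (enumerate-∈ R j)) (sym e))
  toR-injective (suc i) zero    e = ⊥-elim (proj₂ (R⇒ (enumerate-∈ R i)) e)
  toR-injective (suc i) (suc j) e = cong suc (enumerate-injective R i j e)

  private

    a b : ℕ
    a = count L
    b = count R

    toG : Fin (suc a + b) → Fin n
    toG = toL ++ enumerate R

    R-intro : ∀ {v} → L v ≡ false → v ≢ x → R v ≡ true
    R-intro Lv v≢x rewrite Lv | ≢⇒==-false v≢x = refl

    toL≢enumerateR : ∀ α β → toL α ≢ enumerate R β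
    toL≢enumerateR zero    β e = proj₂ (R⇒ (enumerate-∈ R β)) (sym e)
    toL≢enumerateR (suc α) β e =
      ≡false⇒≢true (proj₁ (R⇒ (enumerate-∈ R β))) (subst (λ v → L v ≡ true) e (enumerate-∈ L α))

    toG-↑ˡ : ∀ α → toG (α ↑ˡ b) ≡ toL α
    toG-↑ˡ = Vectorₚ.lookup-++ˡ toL (enumerate R)

    toG-↑ʳ : ∀ β → toG (suc a ↑ʳ β) ≡ enumerate R β
    toG-↑ʳ = Vectorₚ.lookup-++ʳ toL (enumerate R)

    toG-injective : Injective toG
    toG-injective i j e with side (suc a) i | side (suc a) j
    ... | left α | left α′ =
      cong (_↑ˡ b) (toL-injective α α′ (trans (sym (toG-↑ˡ α)) (trans e (toG-↑ˡ α′))))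
    ... | right β | right β′ =
      cong (suc a ↑ʳ_) (enumerate-injective R β β′ (trans (sym (toG-↑ʳ β)) (trans e (toG-↑ʳ β′))))
    ... | left α | right β = ⊥-elim (toL≢enumerateR α β (trans (sym (toG-↑ˡ α)) (trans e (toG-↑ʳ β))))
    ... | right β | left α = ⊥-elim (toL≢enumerateR α β (trans (sym (toG-↑ˡ α)) (trans (sym e) (toG-↑ʳ β))))

    toG-surjective : ∀ t → ∃ λ i → toG i ≡ t
    toG-surjective t with t Finₚ.≟ x | L t in Lt
    ... | yes refl | _ = zero ↑ˡ b , toG-↑ˡ zero
    ... | no _ | true = let i , e = enumerate-surjective L t Lt in suc i ↑ˡ b , trans (toG-↑ˡ (suc i)) e
    ... | no t≢x | false =
      let i , e = enumerate-surjective R t (R-intro Lt t≢x) in suc a ↑ʳ i , trans (toG-↑ʳ i) e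

    ℓ : Fin (suc a) → Fin (suc a + b)
    ℓ α = α ↑ˡ b

    ρ : Fin b → Fin (suc a + b)
    ρ β = suc a ↑ʳ β

    glue : Fin (suc a + b) → Maybe (Fin (suc b))
    glue = oneRight a zero zero

    glue-ℓ0 : glue (ℓ zero) ≡ just zero
    glue-ℓ0 = oneRight-glued a zero zero

    glue-ℓs : ∀ α → glue (ℓ (suc α)) ≡ nothing
    glue-ℓs α = oneRight-↑ˡ a zero zero (suc α) λ ()

    glue-ρ : ∀ β → glue (ρ β) ≡ just (suc β)
    glue-ρ = oneRight-↑ʳ a zero zero

    pullA-ρˡ : ∀ β j → pull (oneLeft a) (adj A) (ρ β) j ≡ false
    pullA-ρˡ β j = pull-nothingˡ (oneLeft a) (adj A) (ρ β) j (leftPart-↑ʳ (suc a) β)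

    pullA-ρʳ : ∀ i β → pull (oneLeft a) (adj A) i (ρ β) ≡ false
    pullA-ρʳ i β = pull-nothingʳ (oneLeft a) (adj A) i (ρ β) (leftPart-↑ʳ (suc a) β)

    pullB-ℓℓ : ∀ α α′ → pull glue (adj B) (ℓ α) (ℓ α′) ≡ false
    pullB-ℓℓ zero zero =
      trans (pull-just glue (adj B) (ℓ zero) (ℓ zero) glue-ℓ0 glue-ℓ0) (adj-irrefl B zero)
    pullB-ℓℓ zero (suc α′) = pull-nothingʳ glue (adj B) (ℓ zero) (ℓ (suc α′)) (glue-ℓs α′)
    pullB-ℓℓ (suc α) α′ = pull-nothingˡ glue (adj B) (ℓ (suc α)) (ℓ α′) (glue-ℓs α)

    L↛R-enumerated : ∀ α β → adj G (enumerate L α) (enumerate R β) ≡ false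
    L↛R-enumerated α β = let Lv , v≢x = R⇒ (enumerate-∈ R β) in L↛R _ _ (enumerate-∈ L α) Lv v≢x

    rel≗ : ∀ i j → oneSum-rel A B zero zero i j ≡ adj G (toG i) (toG j)
    rel≗ i j with side (suc a) i | side (suc a) j
    ... | left α | left α′ =
      trans (cong₂ _∨_ (pull-just (oneLeft a) (adj A) (ℓ α) (ℓ α′)
                                  (leftPart-↑ˡ (suc a) α) (leftPart-↑ˡ (suc a) α′))
                       (pullB-ℓℓ α α′))
            (trans (Boolₚ.∨-identityʳ _) (sym (cong₂ (adj G) (toG-↑ˡ α) (toG-↑ˡ α′))))
    ... | left zero | right β =
      trans (cong₂ _∨_ (pullA-ρʳ (ℓ zero) β) (pull-just glue (adj B) (ℓ zero) (ρ β) glue-ℓ0 (glue-ρ β)))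
            (sym (cong₂ (adj G) (toG-↑ˡ zero) (toG-↑ʳ β)))
    ... | right β | left zero =
      trans (cong₂ _∨_ (pullA-ρˡ β (ℓ zero)) (pull-just glue (adj B) (ρ β) (ℓ zero) (glue-ρ β) glue-ℓ0))
            (sym (cong₂ (adj G) (toG-↑ʳ β) (toG-↑ˡ zero)))
    ... | left (suc α) | right β =
      trans (cong₂ _∨_ (pullA-ρʳ (ℓ (suc α)) β)
                       (pull-nothingˡ glue (adj B) (ℓ (suc α)) (ρ β) (glue-ℓs α)))
            (sym (trans (cong₂ (adj G) (toG-↑ˡ (suc α)) (toG-↑ʳ β)) (L↛R-enumerated α β)))
    ... | right β | left (suc α) =
      trans (cong₂ _∨_ (pullA-ρˡ β (ℓ (suc α)))
                       (pull-nothingʳ glue (adj B) (ρ β) (ℓ (suc α)) (glue-ℓs α)))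
            (sym (trans (cong₂ (adj G) (toG-↑ʳ β) (toG-↑ˡ (suc α)))
                        (trans (adj-sym G _ _) (L↛R-enumerated α β))))
    ... | right β | right β′ =
      trans (cong₂ _∨_ (pullA-ρˡ β (ρ β′))
                       (pull-just glue (adj B) (ρ β) (ρ β′) (glue-ρ β) (glue-ρ β′)))
            (sym (cong₂ (adj G) (toG-↑ʳ β) (toG-↑ʳ β′)))

  oneSum≅G : oneSum A B zero zero ≅ G
  oneSum≅G = ≅-of-bijection {H = oneSum A B zero zero} G toG toG-injective toG-surjective
    (λ i j → sym (adj-simple-≗ (oneSum-rel A B zero zero) (induced G toG) rel≗ i j))

module _ {n} {G : Graph n} (G-min : MinimalNonSesqui G) where

  proper-induced-sesqui : ∀ {k} (f : Fin (suc k) → Fin n) → Injective f → ∀ t → (∀ i → f i ≢ t) →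
                          Sesqui (induced G f)
  proper-induced-sesqui f f-inj t f≢t = proj₂ G-min (s≤s z≤n) (injective-missing⇒< f f-inj t f≢t) f f-inj

  minimal⇒no-cut-vertex : ∀ x (L : Fin n → Bool) → L x ≡ false →
    ∀ {u v} → L u ≡ true → L v ≡ false → v ≢ x →
    (∀ u v → L u ≡ true → L v ≡ false → v ≢ x → adj G u v ≡ false) → ⊥
  minimal⇒no-cut-vertex x L L-x {u} {v} Lu Lv v≢x L↛R =
    proj₁ G-min (iso (sum₁ zero zero (proper-induced-sesqui toL toL-injective v toL≢v)
                                     (proper-induced-sesqui toR toR-injective u toR≢u)) oneSum≅G)
    where
    open CutVertexSplit G x L L-x L↛R

    toL≢v : ∀ i → toL i ≢ v
    toL≢v zero    = ≢-sym v≢x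
    toL≢v (suc i) e = ≡false⇒≢true Lv (subst (λ t → L t ≡ true) e (enumerate-∈ L i))

    toR≢u : ∀ i → toR i ≢ u
    toR≢u zero    e = ≡false⇒≢true L-x (subst (λ t → L t ≡ true) (sym e) Lu)
    toR≢u (suc i) e = ≡false⇒≢true (proj₁ (R⇒ (enumerate-∈ R i))) (subst (λ t → L t ≡ true) (sym e) Lu)

  minimal⇒no-long-induced-cycle : (∀ k → 3 ≤ k → ¬ (G ≅ Cycle k)) → ∀ {k} → 5 ≤ k →
    (f : Fin k → Fin n) → Injective f → (∀ i j → adj G (f i) (f j) ≡ adj (Cycle k) i j) → ⊥
  minimal⇒no-long-induced-cycle not-cycle {k} 5≤k f f-inj f-adj with k ℕ.<? n
  ... | yes k<n = sesqui⇒¬indecomposable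
                    (iso (proj₂ G-min (<-≤-trans (s≤s z≤n) 5≤k) k<n f f-inj) induced≅cycle)
                    (cycle-indecomposable 5≤k)
    where
    induced≅cycle : induced G f ≅ Cycle k
    induced≅cycle = ↔-refl , λ i j → sym (f-adj i j)
  ... | no k≮n = not-cycle k (≤-trans (s≤s (s≤s (s≤s z≤n))) 5≤k)
    (≅-sym {G = Cycle k} {G}
      (≅-of-bijection {H = Cycle k} G f f-inj (injective⇒surjective f f-inj (≮⇒≥ k≮n)) f-adj))

-- Balls and geodesics

anyᵇ : ∀ {n} → (Fin n → Bool) → Bool
anyᵇ p = does (Finₚ.any? λ u → p u Boolₚ.≟ true)

anyᵇ-intro : ∀ {n} (p : Fin n → Bool) u → p u ≡ true → anyᵇ p ≡ true
anyᵇ-intro p u pu = dec-true (Finₚ.any? λ v → p v Boolₚ.≟ true) (u , pu)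

anyᵇ⇒ : ∀ {n} (p : Fin n → Bool) → anyᵇ p ≡ true → ∃ λ u → p u ≡ true
anyᵇ⇒ p = does⇒ (Finₚ.any? λ v → p v Boolₚ.≟ true)

extend : ∀ {A : Set} → (ℕ → A) → ℕ → (ℕ → A) → ℕ → A
extend f m g t = if does (t ℕ.≤? m) then f t else g t

extend-≤ : ∀ {A : Set} (f : ℕ → A) m g {t} → t ≤ m → extend f m g t ≡ f t
extend-≤ f m g {t} t≤m rewrite dec-true (t ℕ.≤? m) t≤m = refl

extend-≰ : ∀ {A : Set} (f : ℕ → A) m g {t} → ¬ t ≤ m → extend f m g t ≡ g t
extend-≰ f m g {t} t≰m rewrite dec-false (t ℕ.≤? m) t≰m = refl

module Ball {n} (G : Graph n) (allowed : Fin n → Bool) (w : Fin n) (w-allowed : allowed w ≡ true) where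

  ball : ℕ → Fin n → Bool
  ball zero v = v == w
  ball (suc i) v = ball i v ∨ (allowed v ∧ anyᵇ (λ u → ball i u ∧ adj G u v))

  ball-suc : ∀ i → ball i ⊆ ball (suc i)
  ball-suc i v = ∨-trueˡ _

  ball-mono : ∀ {i j} v → i ≤ j → ball i v ≡ true → ball j v ≡ true
  ball-mono v i≤j = go (≤⇒≤′ i≤j)
    where
    go : ∀ {i j} → i ℕ.≤′ j → ball i v ≡ true → ball j v ≡ true
    go ℕ.≤′-refl e = e
    go {j = suc j} (ℕ.≤′-step i≤′j) e = ball-suc j v (go i≤′j e)

  center∈ball : ∀ i → ball i w ≡ true
  center∈ball i = ball-mono {0} {i} w z≤n (==-refl w)

  ball-step : ∀ i {u v} → ball i u ≡ true → Adj G u v → allowed v ≡ true → ball (suc i) v ≡ true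
  ball-step i {u} {v} bu uv av = ∨-trueʳ (ball i v)
    (trans (cong (_∧ anyᵇ (λ u → ball i u ∧ adj G u v)) av)
           (anyᵇ-intro (λ u → ball i u ∧ adj G u v) u (cong₂ _∧_ bu uv)))

  ball⊆allowed : ∀ i → ball i ⊆ allowed
  ball⊆allowed zero v e = subst (λ t → allowed t ≡ true) (sym (==⇒≡ e)) w-allowed
  ball⊆allowed (suc i) v e with ∨-true⇒⊎ (ball i v) e
  ... | inj₁ old = ball⊆allowed i v old
  ... | inj₂ new = Boolₚ.∧-conicalˡ _ _ new

  ball-pred : ∀ i v → ball (suc i) v ≡ true → ball i v ≡ false →
              ∃ λ u → ball i u ≡ true × Adj G u v
  ball-pred i v e not-old with ∨-true⇒⊎ (ball i v) e
  ... | inj₁ old = ⊥-elim (≡false⇒≢true not-old old)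
  ... | inj₂ new with anyᵇ⇒ (λ u → ball i u ∧ adj G u v) (Boolₚ.∧-conicalʳ _ _ new)
  ...   | u , e′ = u , Boolₚ.∧-conicalˡ _ _ e′ , Boolₚ.∧-conicalʳ _ _ e′

  Stable : ℕ → Set
  Stable j = ∀ v → ball (suc j) v ≡ ball j v

  stable-closed : ∀ {j} → Stable j → ∀ {u v} → ball j u ≡ true → Adj G u v → allowed v ≡ true →
                  ball j v ≡ true
  stable-closed {j} st {v = v} bu uv av = trans (sym (st v)) (ball-step j bu uv av)

  stable-or-growing : ∀ i → (∃ Stable) ⊎ (i ≤ count (ball i))
  stable-or-growing zero = inj₂ z≤n
  stable-or-growing (suc i) with stable-or-growing i
  ... | inj₁ st = inj₁ st
  ... | inj₂ i≤ with ⊆⇒≗⊎new (ball-suc i)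
  ...   | inj₁ st = inj₁ (i , st)
  ...   | inj₂ (v , new , old) = inj₂ (≤-trans (s≤s i≤) (count-strict (ball-suc i) v new old))

  -- Until they stabilise the balls grow strictly, and they have at most n vertices.
  stable : ∃ Stable
  stable with stable-or-growing (suc n)
  ... | inj₁ st = st
  ... | inj₂ n<count = ⊥-elim (1+n≰n (≤-trans n<count (count≤n (ball (suc n)))))

  AtDistance : Fin n → ℕ → Set
  AtDistance v zero    = ball zero v ≡ true
  AtDistance v (suc m) = ball (suc m) v ≡ true × ball m v ≡ false

  distance⇒ball : ∀ {v} m → AtDistance v m → ball m v ≡ true
  distance⇒ball zero    d = d
  distance⇒ball (suc m) (d , _) = d

  distance⇒outside : ∀ {v} m → AtDistance v m → ∀ i → i < m → ball i v ≡ false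
  distance⇒outside {v} (suc m) (_ , outside) i (s≤s i≤m) with ball i v in bi
  ... | false = refl
  ... | true  = ⊥-elim (≡false⇒≢true outside (ball-mono v i≤m bi))

  distance-unique : ∀ {v} a b → AtDistance v a → AtDistance v b → a ≡ b
  distance-unique a b da db with <-cmp a b
  ... | tri< a<b _ _ = ⊥-elim (≡false⇒≢true (distance⇒outside b db a a<b) (distance⇒ball a da))
  ... | tri≈ _ a≡b _ = a≡b
  ... | tri> _ _ b<a = ⊥-elim (≡false⇒≢true (distance⇒outside a da b b<a) (distance⇒ball b db))

  distance-adj : ∀ {u v} a b → AtDistance u a → AtDistance v b → Adj G u v → allowed v ≡ true →
                 b ≤ suc a
  distance-adj a b du dv uv av with b ℕ.≤? suc a
  ... | yes b≤a+1 = b≤a+1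
  ... | no b≰a+1 = ⊥-elim (≡false⇒≢true (distance⇒outside b dv (suc a) (≰⇒> b≰a+1))
                                         (ball-step a (distance⇒ball a du) uv av))

  ball⇒distance : ∀ j v → ball j v ≡ true → ∃ (AtDistance v)
  ball⇒distance zero v e = zero , e
  ball⇒distance (suc j) v e with ball j v Boolₚ.≟ true
  ... | yes bj = ball⇒distance j v bj
  ... | no bj  = suc j , e , Boolₚ.¬-not bj

  distance-pred : ∀ v m → AtDistance v (suc m) → ∃ λ u → AtDistance u m × Adj G u v
  distance-pred v m (e , outside) with ball-pred m v e outside
  distance-pred v zero _ | u , bu , uv = u , bu , uv
  distance-pred v (suc m) (e , outside) | u , bu , uv with ball m u Boolₚ.≟ true
  ... | no bmu = u , (bu , Boolₚ.¬-not bmu) , uv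
  ... | yes bmu = ⊥-elim (≡false⇒≢true outside (ball-step m bmu uv (ball⊆allowed (suc (suc m)) v e)))

  -- vertex t is meaningful only for t ≤ m.
  record Geodesic (m : ℕ) (v : Fin n) : Set where
    field
      vertex      : ℕ → Fin n
      vertex-end  : vertex m ≡ v
      vertex-dist : ∀ t → t ≤ m → AtDistance (vertex t) t
      vertex-adj  : ∀ t → t < m → Adj G (vertex t) (vertex (suc t))

  geodesic : ∀ m v → AtDistance v m → Geodesic m v
  geodesic zero v d = record
    { vertex      = λ _ → v
    ; vertex-end  = refl
    ; vertex-dist = λ { .zero z≤n → d }
    ; vertex-adj  = λ _ ()
    }
  geodesic (suc m) v d with distance-pred v m d
  ... | u , du , uv = record
    { vertex      = vertex′
    ; vertex-end  = new 1+n≰n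
    ; vertex-dist = vertex-dist′
    ; vertex-adj  = vertex-adj′
    }
    where
    module P = Geodesic (geodesic m u du)

    vertex′ : ℕ → Fin n
    vertex′ = extend P.vertex m (λ _ → v)

    old : ∀ {t} → t ≤ m → vertex′ t ≡ P.vertex t
    old = extend-≤ P.vertex m (λ _ → v)

    new : ∀ {t} → ¬ t ≤ m → vertex′ t ≡ v
    new = extend-≰ P.vertex m (λ _ → v)

    vertex-dist′ : ∀ t → t ≤ suc m → AtDistance (vertex′ t) t
    vertex-dist′ t t≤m+1 with t ℕ.≤? m
    ... | yes t≤m = subst (λ x → AtDistance x t) (sym (old t≤m)) (P.vertex-dist t t≤m)
    ... | no t≰m with ≤-antisym t≤m+1 (≰⇒> t≰m)
    ...   | refl = subst (λ x → AtDistance x (suc m)) (sym (new t≰m)) d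

    vertex-adj′ : ∀ t → t < suc m → Adj G (vertex′ t) (vertex′ (suc t))
    vertex-adj′ t (s≤s t≤m) with suc t ℕ.≤? m
    ... | yes t<m = subst₂ (Adj G) (sym (old t≤m)) (sym (old t<m)) (P.vertex-adj t t<m)
    ... | no t≮m with ≤-antisym t≤m (≤-pred (≰⇒> t≮m))
    ...   | refl = subst₂ (Adj G) (sym (trans (old t≤m) P.vertex-end)) (sym (new t≮m)) uv

module Counterexample {n} (G : Graph n) (G-min : MinimalNonSesqui G)
  (not-cycle : ∀ k → 3 ≤ k → ¬ (G ≅ Cycle k))
  {w x y z : Fin n} (w≢x : w ≢ x) (w≢y : w ≢ y) (w≢z : w ≢ z) (x≢y : x ≢ y) (x≢z : x ≢ z)
  (wx : Adj G w x) (xy : Adj G x y) (yz : Adj G y z) (deg-x : degree G x ≡ 2) (deg-y : degree G y ≡ 2)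
  (w≁z : adj G w z ≡ false) where

  allowed : Fin n → Bool
  allowed v = not (v == x) ∧ not (v == y)

  allowed-intro : ∀ {v} → v ≢ x → v ≢ y → allowed v ≡ true
  allowed-intro v≢x v≢y rewrite ≢⇒==-false v≢x | ≢⇒==-false v≢y = refl

  allowed⇒≢x : ∀ {v} → allowed v ≡ true → v ≢ x
  allowed⇒≢x e refl rewrite ==-refl x = ≡false⇒≢true refl e

  allowed⇒≢y : ∀ {v} → allowed v ≡ true → v ≢ y
  allowed⇒≢y {v} e refl rewrite ==-refl y = ≡false⇒≢true (Boolₚ.∧-zeroʳ (not (y == x))) e

  open Ball G allowed w (allowed-intro w≢x w≢y)

  x∉ball : ∀ j → ball j x ≡ false
  x∉ball j = Boolₚ.¬-not (λ bx → allowed⇒≢x (ball⊆allowed j x bx) refl)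

  y∉ball : ∀ j → ball j y ≡ false
  y∉ball j = Boolₚ.¬-not (λ by → allowed⇒≢y (ball⊆allowed j y by) refl)

  neighbour-x : ∀ v → Adj G x v → v ≡ w ⊎ v ≡ y
  neighbour-x = degree-2-neighbours G deg-x (trans (adj-sym G x w) wx) xy w≢y

  neighbour-y : ∀ v → Adj G y v → v ≡ x ⊎ v ≡ z
  neighbour-y = degree-2-neighbours G deg-y (trans (adj-sym G y x) xy) yz x≢z

  separated : ∀ {j} → Stable j → ball j z ≡ false → ⊥
  separated {j} st z∉ball =
    minimal⇒no-cut-vertex G-min x (ball j) (x∉ball j) (center∈ball j) (y∉ball j) (≢-sym x≢y) no-edge
    where
    no-edge : ∀ u v → ball j u ≡ true → ball j v ≡ false → v ≢ x → adj G u v ≡ false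
    no-edge u v bu bv v≢x with adj G u v in uv
    ... | false = refl
    ... | true with v Finₚ.≟ y
    ...   | no v≢y = ⊥-elim (≡false⇒≢true bv (stable-closed {j} st bu uv (allowed-intro v≢x v≢y)))
    ...   | yes refl with neighbour-y u (trans (adj-sym G y u) uv)
    ...     | inj₁ refl = ⊥-elim (≡false⇒≢true (x∉ball j) bu)
    ...     | inj₂ refl = ⊥-elim (≡false⇒≢true z∉ball bu)

  z-far : ∀ m → AtDistance z m → 2 ≤ m
  z-far zero dz = ⊥-elim (w≢z (sym (==⇒≡ dz)))
  z-far (suc zero) dz with distance-pred z 0 dz
  ... | u , du , uz with ==⇒≡ du
  ...   | refl = ⊥-elim (≡false⇒≢true w≁z uz)
  z-far (suc (suc m)) _ = s≤s (s≤s z≤n)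

  module Closing {m} (dz : AtDistance z m) where

    open Geodesic (geodesic m z dz) renaming (vertex to P)

    k : ℕ
    k = 3 + m

    -- The induced cycle w = P 0, P 1, …, P m = z, y, x, of length m + 3.
    data Region : ℕ → Set where
      on-path : ∀ {t} → t ≤ m → Region t
      at-y    : Region (suc m)
      at-x    : Region (suc (suc m))

    region : ∀ {t} → t < k → Region t
    region {t} t<k with t ℕ.≤? m | t ℕ.≟ suc m
    ... | yes t≤m | _ = on-path t≤m
    ... | no _ | yes refl = at-y
    ... | no t≰m | no t≢m+1 with ≤-antisym (≤-pred t<k) (≤∧≢⇒< (≰⇒> t≰m) (≢-sym t≢m+1))
    ...   | refl = at-x

    vertex-at : ∀ {t} → Region t → Fin n
    vertex-at {t} (on-path _) = P t
    vertex-at at-y = y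
    vertex-at at-x = x

    P-dist : ∀ {t} → t ≤ m → AtDistance (P t) t
    P-dist = vertex-dist _

    P-allowed : ∀ {t} → t ≤ m → allowed (P t) ≡ true
    P-allowed {t} t≤m = ball⊆allowed t (P t) (distance⇒ball t (P-dist t≤m))

    P-injective : ∀ {t s} → t ≤ m → s ≤ m → P t ≡ P s → t ≡ s
    P-injective {t} {s} t≤m s≤m e =
      distance-unique t s (P-dist t≤m) (subst (λ v → AtDistance v s) (sym e) (P-dist s≤m))

    P≡z⇒ : ∀ {t} → t ≤ m → P t ≡ z → t ≡ m
    P≡z⇒ {t} t≤m e = distance-unique t m (subst (λ v → AtDistance v t) e (P-dist t≤m)) dz

    P≡w⇒ : ∀ {t} → t ≤ m → P t ≡ w → t ≡ 0
    P≡w⇒ {t} t≤m e = distance-unique t 0 (subst (λ v → AtDistance v t) e (P-dist t≤m)) (==-refl w)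

    P-adj⇒ : ∀ {t s} → t ≤ m → s ≤ m → Adj G (P t) (P s) → CycleEdge k t s
    P-adj⇒ {t} {s} t≤m s≤m e with <-cmp t s
    ... | tri< t<s _ _ = inj₁ (inj₁ (≤-antisym t<s
          (distance-adj t s (P-dist t≤m) (P-dist s≤m) e (P-allowed s≤m))))
    ... | tri≈ _ refl _ = ⊥-elim (≡false⇒≢true (adj-irrefl G (P t)) e)
    ... | tri> _ _ s<t = inj₂ (inj₁ (≤-antisym s<t
          (distance-adj s t (P-dist s≤m) (P-dist t≤m) (trans (adj-sym G _ _) e) (P-allowed t≤m))))

    P-adj-y : ∀ {t} → t ≤ m → Adj G (P t) y → CycleEdge k t (suc m)
    P-adj-y t≤m e with neighbour-y _ (trans (adj-sym G y _) e)
    ... | inj₁ Pt≡x = ⊥-elim (allowed⇒≢x (P-allowed t≤m) Pt≡x)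
    ... | inj₂ Pt≡z = inj₁ (inj₁ (cong suc (P≡z⇒ t≤m Pt≡z)))

    P-adj-x : ∀ {t} → t ≤ m → Adj G (P t) x → CycleEdge k t (suc (suc m))
    P-adj-x t≤m e with neighbour-x _ (trans (adj-sym G x _) e)
    ... | inj₁ Pt≡w = inj₂ (inj₂ (refl , P≡w⇒ t≤m Pt≡w))
    ... | inj₂ Pt≡y = ⊥-elim (allowed⇒≢y (P-allowed t≤m) Pt≡y)

    adj⇒edge : ∀ {a b} (ra : Region a) (rb : Region b) →
               Adj G (vertex-at ra) (vertex-at rb) → CycleEdge k a b
    adj⇒edge (on-path a≤m) (on-path b≤m) e = P-adj⇒ a≤m b≤m e
    adj⇒edge (on-path a≤m) at-y e = P-adj-y a≤m e
    adj⇒edge (on-path a≤m) at-x e = P-adj-x a≤m e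
    adj⇒edge at-y (on-path b≤m) e = swap (P-adj-y b≤m (trans (adj-sym G _ y) e))
    adj⇒edge at-x (on-path b≤m) e = swap (P-adj-x b≤m (trans (adj-sym G _ x) e))
    adj⇒edge at-y at-x _ = inj₁ (inj₁ refl)
    adj⇒edge at-x at-y _ = inj₂ (inj₁ refl)
    adj⇒edge at-y at-y e = ⊥-elim (≡false⇒≢true (adj-irrefl G y) e)
    adj⇒edge at-x at-x e = ⊥-elim (≡false⇒≢true (adj-irrefl G x) e)

    step⇒adj : ∀ {a b} (ra : Region a) (rb : Region b) →
               CycleStep k a b → Adj G (vertex-at ra) (vertex-at rb)
    step⇒adj {a} (on-path _) (on-path a+1≤m) (inj₁ refl) = vertex-adj a a+1≤m
    step⇒adj (on-path _) at-y (inj₁ refl) =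
      subst (λ v → Adj G v y) (sym vertex-end) (trans (adj-sym G z y) yz)
    step⇒adj at-y at-x (inj₁ refl) = trans (adj-sym G y x) xy
    step⇒adj at-x (on-path _) (inj₂ (_ , refl)) =
      subst (Adj G x) (sym (==⇒≡ (P-dist z≤n))) (trans (adj-sym G x w) wx)
    step⇒adj (on-path m+1≤m) at-x (inj₁ refl) = ⊥-elim (1+n≰n m+1≤m)
    step⇒adj at-y (on-path m+2≤m) (inj₁ refl) = ⊥-elim (1+n≰n (≤-trans (n≤1+n _) m+2≤m))
    step⇒adj at-x (on-path m+3≤m) (inj₁ refl) =
      ⊥-elim (1+n≰n (≤-trans (n≤1+n _) (≤-trans (n≤1+n _) m+3≤m)))
    step⇒adj (on-path a≤m) _ (inj₂ (a+1≡k , _)) =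
      ⊥-elim (1+n≰n (≤-trans (n≤1+n (suc m)) (subst (_≤ m) (suc-injective a+1≡k) a≤m)))
    step⇒adj at-y _ (inj₂ (() , _))
    step⇒adj at-y at-y (inj₁ e) = ⊥-elim (1+n≢n e)
    step⇒adj at-x at-x (inj₁ e) = ⊥-elim (1+n≢n e)
    step⇒adj at-x at-y (inj₁ e) = ⊥-elim (m≢1+n+m m (sym (suc-injective e)))
    step⇒adj at-x at-y (inj₂ (_ , ()))
    step⇒adj at-x at-x (inj₂ (_ , ()))

    vertex-at-injective : ∀ {a b} (ra : Region a) (rb : Region b) → vertex-at ra ≡ vertex-at rb → a ≡ b
    vertex-at-injective (on-path a≤m) (on-path b≤m) e = P-injective a≤m b≤m e
    vertex-at-injective (on-path a≤m) at-y e = ⊥-elim (allowed⇒≢y (P-allowed a≤m) e)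
    vertex-at-injective (on-path a≤m) at-x e = ⊥-elim (allowed⇒≢x (P-allowed a≤m) e)
    vertex-at-injective at-y (on-path b≤m) e = ⊥-elim (allowed⇒≢y (P-allowed b≤m) (sym e))
    vertex-at-injective at-x (on-path b≤m) e = ⊥-elim (allowed⇒≢x (P-allowed b≤m) (sym e))
    vertex-at-injective at-y at-y _ = refl
    vertex-at-injective at-x at-x _ = refl
    vertex-at-injective at-y at-x e = ⊥-elim (x≢y (sym e))
    vertex-at-injective at-x at-y e = ⊥-elim (x≢y e)

    region-of : (i : Fin k) → Region (toℕ i)
    region-of i = region (Finₚ.toℕ<n i)

    cycle : Fin k → Fin n
    cycle i = vertex-at (region-of i)

    cycle-adj : ∀ i j → adj G (cycle i) (cycle j) ≡ adj (Cycle k) i j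
    cycle-adj i j = Boolₚ.⇔→≡ (mk⇔
      (edge⇒adj-Cycle (s≤s (s≤s z≤n)) i j ∘ adj⇒edge (region-of i) (region-of j))
      (λ e → [ step⇒adj (region-of i) (region-of j)
             , (λ s → trans (adj-sym G _ _) (step⇒adj (region-of j) (region-of i) s)) ]′
               (adj-Cycle⇒edge i j e)))

    closing : ⊥
    closing = minimal⇒no-long-induced-cycle G-min not-cycle (s≤s (s≤s (s≤s (z-far m dz)))) cycle
      (λ i j e → Finₚ.toℕ-injective (vertex-at-injective (region-of i) (region-of j) e)) cycle-adj

  impossible : ⊥
  impossible with stable
  ... | j , st with ball j z in bz
  ...   | false = separated {j} st bz
  ...   | true  = Closing.closing (proj₂ (ball⇒distance j z bz))

lemma3p6 : ∀ {n} (G : Graph n) → MinimalNonSesqui G →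
    (∀ k → 3 ≤ k → ¬ (G ≅ Cycle k)) →
    (w x y z : Fin n) →
    ¬ w ≡ x → ¬ w ≡ y → ¬ w ≡ z → ¬ x ≡ y → ¬ x ≡ z → ¬ y ≡ z →
    Adj G w x → Adj G x y → Adj G y z →
    degree G x ≡ 2 → degree G y ≡ 2 →
    Adj G w z
lemma3p6 G G-min not-cycle w x y z w≢x w≢y w≢z x≢y x≢z _ wx xy yz deg-x deg-y with adj G w z in wz
... | true  = refl
... | false =
  ⊥-elim (Counterexample.impossible G G-min not-cycle w≢x w≢y w≢z x≢y x≢z wx xy yz deg-x deg-y wz)
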